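{- Let $G$ be a connected claw-free graph of order $n \ge 2$. Then (a) $\Psi_g^+(G) \ge \frac{1}{2}n$; and (b) if $G$ is not the path $P_3$ on three vertices, then $\Psi_g^-(G) \ge \frac{1}{2}n$.
   Context: All graphs are finite and simple. A graph is claw-free if it has no induced subgraph isomorphic to $K_{1,3}$. For a set $S$ of vertices of a graph $G$, a vertex $v \in S$ is an enclave of $S$ if $N[v] \subseteq S$; $S$ is enclaveless if it contains no enclave. The competition-enclaveless game on $G$ is played by Maximizer and Minimizer, who alternately choose a vertex $v$ not in the set $S$ of previously chosen vertices such that $S \cup \{v\}$ is enclaveless; the game ends when no such vertex exists. Maximizer aims to maximize and Minimizer to minimize the final $|S|$. $\Psi_g^+(G)$ is the final $|S|$ when Maximizer moves first and both play optimally; $\Psi_g^-(G)$ is the same when Minimizer moves first. -}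

module Defs where

open import Data.Nat using (ℕ; zero; suc; _+_; _⊔_; _⊓_)
open import Data.Fin using (Fin; zero; suc)
open import Data.Bool using (Bool; true; false; _∧_; _∨_; not; if_then_else_)
open import Data.List using (List; []; _∷_; filter; foldr; map; allFin)
open import Data.Nat.ListAction using (sum)
open import Data.Product using (Σ; _×_; ∃; _,_)
open import Relation.Binary.PropositionalEquality using (_≡_; _≢_)
open import Relation.Nullary using (¬_)
open import Relation.Nullary.Decidable using (does)
open import Data.Bool using (T)
open import Data.Bool.Properties using (T?)

record Graph (n : ℕ) : Set where
  field
    adj    : Fin n → Fin n → Bool
    sym    : ∀ u v → adj u v ≡ adj v u
    irrefl : ∀ v → adj v v ≡ false
open Graph public

_~[_]_ : ∀ {n} → Fin n → Graph n → Fin n → Set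
u ~[ G ] v = adj G u v ≡ true

data Reach {n} (G : Graph n) : Fin n → Fin n → Set where
  here : ∀ {v} → Reach G v v
  step : ∀ {u w v} → u ~[ G ] w → Reach G w v → Reach G u v

Connected : ∀ {n} → Graph n → Set
Connected G = ∀ u v → Reach G u v

ClawFree : ∀ {n} → Graph n → Set
ClawFree {n} G = ¬ (Σ (Fin n) λ c → Σ (Fin n) λ a → Σ (Fin n) λ b → Σ (Fin n) λ d →
    (c ~[ G ] a) × (c ~[ G ] b) × (c ~[ G ] d)
  × (a ≢ b) × (a ≢ d) × (b ≢ d)
  × (adj G a b ≡ false) × (adj G a d ≡ false) × (adj G b d ≡ false))

Iso : ∀ {n m} → Graph n → Graph m → Set
Iso {n} {m} G H = Σ (Fin n → Fin m) λ f → Σ (Fin m → Fin n) λ g →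
  (∀ x → g (f x) ≡ x) × (∀ y → f (g y) ≡ y) × (∀ u v → adj H (f u) (f v) ≡ adj G u v)

p3adj : Fin 3 → Fin 3 → Bool
p3adj zero (suc zero) = true
p3adj (suc zero) zero = true
p3adj (suc zero) (suc (suc zero)) = true
p3adj (suc (suc zero)) (suc zero) = true
p3adj _ _ = false

P3 : Graph 3
P3 = record { adj = p3adj ; sym = s ; irrefl = i }
  where
  s : ∀ u v → p3adj u v ≡ p3adj v u
  s zero zero = _≡_.refl
  s zero (suc zero) = _≡_.refl
  s zero (suc (suc zero)) = _≡_.refl
  s (suc zero) zero = _≡_.refl
  s (suc zero) (suc zero) = _≡_.refl
  s (suc zero) (suc (suc zero)) = _≡_.refl
  s (suc (suc zero)) zero = _≡_.refl
  s (suc (suc zero)) (suc zero) = _≡_.refl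
  s (suc (suc zero)) (suc (suc zero)) = _≡_.refl
  i : ∀ v → p3adj v v ≡ false
  i zero = _≡_.refl
  i (suc zero) = _≡_.refl
  i (suc (suc zero)) = _≡_.refl

IsP3 : ∀ {n} → Graph n → Set
IsP3 G = Iso G P3

VSet : ℕ → Set
VSet n = Fin n → Bool

∅ : ∀ {n} → VSet n
∅ _ = false

insert : ∀ {n} → Fin n → VSet n → VSet n
insert {n} v S u = does (u Data.Fin.≟ v) ∨ S u

size : ∀ {n} → VSet n → ℕ
size {n} S = sum (map (λ v → if S v then 1 else 0) (allFin n))

allB : ∀ {n} → (Fin n → Bool) → Bool
allB {n} p = foldr (λ v b → p v ∧ b) true (allFin n)

anyB : ∀ {n} → (Fin n → Bool) → Bool
anyB {n} p = foldr (λ v b → p v ∨ b) false (allFin n)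

isEnclave : ∀ {n} → Graph n → VSet n → Fin n → Bool
isEnclave G S v = S v ∧ allB (λ u → not (adj G v u) ∨ S u)

enclaveless : ∀ {n} → Graph n → VSet n → Bool
enclaveless G S = not (anyB (isEnclave G S))

legal : ∀ {n} → Graph n → VSet n → List (Fin n)
legal {n} G S = filter (λ v → T? (not (S v) ∧ enclaveless G (insert v S))) (allFin n)

data Player : Set where
  Maximizer Minimizer : Player

other : Player → Player
other Maximizer = Minimizer
other Minimizer = Maximizer

-- Optimal final size of the game from position S with player p to move,
-- computed by minimax; the fuel bounds the number of remaining moves
-- (each move adds a new vertex, so fuel n suffices from ∅).
value : ∀ {n} → Graph n → ℕ → Player → VSet n → ℕ
value G zero p S = size S
value G (suc k) p S with legal G S
... | [] = size S
... | v ∷ vs = combine p (map (λ w → value G k (other p) (insert w S)) vs)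
                        (value G k (other p) (insert v S))
  where
  combine : Player → List ℕ → ℕ → ℕ
  combine Maximizer xs x = foldr _⊔_ x xs
  combine Minimizer xs x = foldr _⊓_ x xs

Ψ⁺ : ∀ {n} → Graph n → ℕ
Ψ⁺ {n} G = value G n Maximizer ∅

Ψ⁻ : ∀ {n} → Graph n → ℕ
Ψ⁻ {n} G = value G n Minimizer ∅

-- Call S ⊆ V maximal if it is enclaveless but S ∪ {x} is not for any x ∉ S; every game ends in
-- such a set. If the vertices outside some X ⊆ S have distinct neighbours f x, then |V ∖ S| ≤ |S|:
-- charge x ∉ S to f x when f x ∈ S, and otherwise to an enclave of S ∪ {x}. By Sumner's theorem a
-- connected claw-free graph of even order has a perfect matching (so X = ∅ will do), and for odd
-- order G − c has one whenever c is not a cut vertex (so X = {c} will do once c has been played).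
-- Maximizer therefore opens with a vertex c farthest from some root, which is never a cut vertex.
-- If Minimizer opens with u on a graph of odd order, Maximizer answers with a non-cut vertex v for
-- which {u, v} is enclaveless; the breadth-first levels from u supply v unless G is a star centred
-- at u, and a claw-free star is P3.
module Submission where

open import Data.Bool using (Bool; true; false; _∧_; _∨_; not; if_then_else_)
import Data.Bool as Bool
open import Data.Bool.Properties
  using (T?; T-≡; ¬-not; not-injective; ∧-conicalˡ; ∧-conicalʳ; ∨-conicalˡ; ∨-conicalʳ)
open import Data.Empty using (⊥; ⊥-elim)
open import Data.Fin using (Fin; zero; suc; _≟_)
open import Data.Fin.Permutation.Components using (transpose; transpose-inverse)
open import Data.Fin.Properties using (any?)
open import Data.List using (List; []; _∷_; filter; foldr; map; allFin; length)
open import Data.List.Extrema.Nat using (argmax; argmax-all; f[xs]≤f[argmax])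
open import Data.List.Membership.Propositional using (_∈_)
open import Data.List.Membership.Propositional.Properties
  using (∈-filter⁺; ∈-filter⁻; ∈-allFin; ∈-map⁺)
open import Data.List.Properties using (length-tabulate; foldr-preservesᵒ; foldr-preservesᵇ)
open import Data.List.Relation.Unary.All as All using (All; _∷_)
import Data.List.Relation.Unary.All.Properties as Allₚ
open import Data.List.Relation.Unary.AllPairs using (_∷_)
open import Data.List.Relation.Unary.Any as Any using (Any; here; there)
open import Data.List.Relation.Unary.Unique.Propositional using (Unique)
import Data.List.Relation.Unary.Unique.Propositional.Properties as Uniqueₚ
import Data.Nat as ℕ
open import Data.Nat using (ℕ; zero; suc; _+_; _*_; _≤_; _<_; z≤n; s≤s; s≤s⁻¹; ⌊_/2⌋; ⌈_/2⌉)
open import Data.Nat.ListAction using (sum)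
open import Data.Nat.Properties
  using ( ≤-refl; ≤-reflexive; ≤-trans; ≤-antisym; <-irrefl; <⇒≱; ≮⇒≥; n≤1+n; n≤0⇒n≡0
        ; n≢0⇒n>0; m<1+n⇒m<n∨m≡n; suc-injective; 0≢1+n; +-comm; +-suc; +-identityʳ
        ; +-mono-≤; +-monoʳ-≤; m≤n⇒m≤n⊔o; m≤n⇒m≤o⊔n; ⊓-glb
        ; ⌈n/2⌉-mono; ⌈n/2⌉≤n; ⌊n/2⌋≤⌈n/2⌉; ⌊n/2⌋+⌈n/2⌉≡n; n≡⌈n+n/2⌉; module ≤-Reasoning)
open import Data.Product using (Σ; ∃; _×_; _,_; proj₁; proj₂)
open import Data.Sum using (_⊎_; inj₁; inj₂; [_,_])
open import Function using (_∘_; case_of_)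
open import Function.Bundles using (Equivalence)
open import Relation.Binary.PropositionalEquality
  using (_≡_; _≢_; refl; sym; trans; cong; cong₂; subst; subst₂; ≢-sym; module ≡-Reasoning)
open import Relation.Nullary using (¬_; Dec; yes; no; does)
open import Relation.Nullary.Decidable using (_×-dec_; dec-true)
open import Relation.Unary using (Decidable)

open import Defs hiding (sym)

module _ {A : Set} where

  drop-member : ∀ {y} {ys : List A} → y ∈ ys →
    Σ (List A) λ zs → length ys ≡ suc (length zs) × (∀ {z} → z ∈ ys → z ≢ y → z ∈ zs)
  drop-member {ys = _ ∷ zs} (here refl) =
    zs , refl , λ { (here refl) z≢y → ⊥-elim (z≢y refl) ; (there z∈) _ → z∈ }
  drop-member {ys = w ∷ _} (there y∈) with drop-member y∈
  ... | zs , len , keep =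
    w ∷ zs , cong suc len , λ { (here refl) _ → here refl ; (there z∈) z≢y → there (keep z∈ z≢y) }

  injectiveRel⇒length≤ : (R : A → A → Set) (xs ys : List A) → Unique xs →
    (∀ {x} → x ∈ xs → ∃ λ y → y ∈ ys × R x y) →
    (∀ {x x′ y} → R x y → R x′ y → x ≡ x′) → length xs ≤ length ys
  injectiveRel⇒length≤ R [] ys _ _ _ = z≤n
  injectiveRel⇒length≤ R (x ∷ xs) ys (x∉xs ∷ unique) image injective
    with y , y∈ys , Rxy ← image (here refl)
    with zs , len , keep ← drop-member y∈ys =
    subst (suc (length xs) ≤_) (sym len) (s≤s (injectiveRel⇒length≤ R xs zs unique image′ injective))
    where
    image′ : ∀ {x′} → x′ ∈ xs → ∃ λ y′ → y′ ∈ zs × R x′ y′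
    image′ x′∈ with y′ , y′∈ , Rx′y′ ← image (there x′∈) =
      y′ , keep y′∈ (λ { refl → All.lookup x∉xs x′∈ (injective Rxy Rx′y′) }) , Rx′y′

module _ {P : ℕ → Set} (P? : Decidable P) where

  least-witness : ∀ {m} → P m → ∃ λ k → P k × (∀ {j} → j < k → ¬ P j)
  least-witness {m} = search 0 m (λ ())
    where
    search : ∀ k f → (∀ {j} → j < k → ¬ P j) → P (k + f) → ∃ λ k → P k × (∀ {j} → j < k → ¬ P j)
    search k zero below p = k , subst P (+-identityʳ k) p , below
    search k (suc f) below p with P? k
    ... | yes pk = k , pk , below
    ... | no ¬pk = search (suc k) f below′ (subst P (+-suc k f) p)
      where
      below′ : ∀ {j} → j < suc k → ¬ P j
      below′ j<1+k with m<1+n⇒m<n∨m≡n j<1+k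
      ... | inj₁ j<k = below j<k
      ... | inj₂ refl = ¬pk

parity : ∀ m → ∃ λ k → m ≡ k + k ⊎ m ≡ suc (k + k)
parity zero = 0 , inj₁ refl
parity (suc m) with parity m
... | k , inj₁ refl = k , inj₂ refl
... | k , inj₂ refl = suc k , inj₁ (cong suc (sym (+-suc k k)))

0<⇒≡suc : ∀ {m} → 0 < m → ∃ λ e → m ≡ suc e
0<⇒≡suc (s≤s _) = _ , refl

k+k≤1⇒k≡0 : ∀ {k} → k + k ≤ 1 → k ≡ 0
k+k≤1⇒k≡0 {zero} _ = refl
k+k≤1⇒k≡0 {suc k} (s≤s k+1+k≤0) with () ← subst (_≤ 0) (+-suc k k) k+1+k≤0

odd≤3⇒≡3 : ∀ {m k} → 2 + m ≡ suc (k + k) → 2 + m ≤ 3 → 2 + m ≡ 3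
odd≤3⇒≡3 {zero} {zero} ()
odd≤3⇒≡3 {zero} {suc k} odd _ with () ← trans (suc-injective (suc-injective odd)) (+-suc k k)
odd≤3⇒≡3 {suc zero} _ _ = refl
odd≤3⇒≡3 {suc (suc _)} _ (s≤s (s≤s (s≤s ())))

⌈a+b/2⌉≤a : ∀ a {b} → b ≤ a → ⌈ a + b /2⌉ ≤ a
⌈a+b/2⌉≤a a b≤a = ≤-trans (⌈n/2⌉-mono (+-monoʳ-≤ a b≤a)) (≤-reflexive (sym (n≡⌈n+n/2⌉ a)))

⌈n/2⌉≤m⇒n≤2m : ∀ n {m} → ⌈ n /2⌉ ≤ m → n ≤ 2 * m
⌈n/2⌉≤m⇒n≤2m n {m} half≤m = begin
  n                   ≡⟨ sym (⌊n/2⌋+⌈n/2⌉≡n n) ⟩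
  ⌊ n /2⌋ + ⌈ n /2⌉   ≤⟨ +-mono-≤ (≤-trans (⌊n/2⌋≤⌈n/2⌉ n) half≤m) half≤m ⟩
  m + m               ≡⟨ cong (m +_) (sym (+-identityʳ m)) ⟩
  2 * m               ∎
  where open ≤-Reasoning

-- Vertex sets

module _ {n : ℕ} where

  infix 4 _∈ᵥ_ _∉ᵥ_ _⊆ᵥ_

  _∈ᵥ_ _∉ᵥ_ : Fin n → VSet n → Set
  x ∈ᵥ S = S x ≡ true
  x ∉ᵥ S = S x ≡ false

  _⊆ᵥ_ : VSet n → VSet n → Set
  S ⊆ᵥ T = ∀ {x} → x ∈ᵥ S → x ∈ᵥ T

  full : VSet n
  full _ = true

  remove : Fin n → VSet n → VSet n
  remove c S x = not (does (x ≟ c)) ∧ S x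

  ∈×∉⇒⊥ : ∀ {x S} → x ∈ᵥ S → x ∉ᵥ S → ⊥
  ∈×∉⇒⊥ x∈ x∉ with () ← trans (sym x∈) x∉

  ∈-insert-self : ∀ v S → v ∈ᵥ insert v S
  ∈-insert-self v S with v ≟ v
  ... | yes _ = refl
  ... | no v≢v = ⊥-elim (v≢v refl)

  insert-other : ∀ {x v : Fin n} S → x ≢ v → insert v S x ≡ S x
  insert-other {x} {v} S x≢v with x ≟ v
  ... | yes x≡v = ⊥-elim (x≢v x≡v)
  ... | no _ = refl

  ∈-insert⁺ : ∀ {x} v S → x ∈ᵥ S → x ∈ᵥ insert v S
  ∈-insert⁺ {x} v S x∈ with x ≟ v
  ... | yes _ = refl
  ... | no _ = x∈

  ∈-insert⁻ : ∀ {x v} S → x ∈ᵥ insert v S → x ≡ v ⊎ x ∈ᵥ S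
  ∈-insert⁻ {x} {v} S x∈ with x ≟ v
  ... | yes x≡v = inj₁ x≡v
  ... | no _ = inj₂ x∈

  ∈-singleton⁻ : ∀ {x v} → x ∈ᵥ insert v ∅ → x ≡ v
  ∈-singleton⁻ x∈ with ∈-insert⁻ ∅ x∈
  ... | inj₁ x≡v = x≡v

  ∈-remove⁺ : ∀ {x c} S → x ≢ c → x ∈ᵥ S → x ∈ᵥ remove c S
  ∈-remove⁺ {x} {c} S x≢c x∈ with x ≟ c
  ... | yes x≡c = ⊥-elim (x≢c x≡c)
  ... | no _ = x∈

  ∈-remove⁻ : ∀ {x c} S → x ∈ᵥ remove c S → x ≢ c × x ∈ᵥ S
  ∈-remove⁻ {x} {c} S x∈ with x ≟ c
  ... | no x≢c = x≢c , x∈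

  remove-self : ∀ c S → c ∉ᵥ remove c S
  remove-self c S with c ≟ c
  ... | yes _ = refl
  ... | no c≢c = ⊥-elim (c≢c refl)

  anyB-true⁺ : ∀ (p : Fin n → Bool) {v} → p v ≡ true → anyB p ≡ true
  anyB-true⁺ p {v} pv = go (allFin n) (∈-allFin v)
    where
    go : ∀ l → v ∈ l → foldr (λ v b → p v ∨ b) false l ≡ true
    go (x ∷ l) (here refl) rewrite pv = refl
    go (x ∷ l) (there v∈) with p x
    ... | true = refl
    ... | false = go l v∈

  anyB-true⁻ : ∀ (p : Fin n → Bool) → anyB p ≡ true → ∃ λ v → p v ≡ true
  anyB-true⁻ p = go (allFin n)
    where
    go : ∀ l → foldr (λ v b → p v ∨ b) false l ≡ true → ∃ λ v → p v ≡ true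
    go (x ∷ l) found with p x in px
    ... | true = x , px
    ... | false = go l found

  anyB-false⁻ : ∀ (p : Fin n → Bool) → anyB p ≡ false → ∀ v → p v ≡ false
  anyB-false⁻ p none v with p v in pv
  ... | false = refl
  ... | true with () ← trans (sym (anyB-true⁺ p pv)) none

  anyB-false⁺ : ∀ (p : Fin n → Bool) → (∀ v → p v ≡ false) → anyB p ≡ false
  anyB-false⁺ p none = go (allFin n)
    where
    go : ∀ l → foldr (λ v b → p v ∨ b) false l ≡ false
    go [] = refl
    go (x ∷ l) rewrite none x = go l

  allB-true⁻ : ∀ (p : Fin n → Bool) → allB p ≡ true → ∀ v → p v ≡ true
  allB-true⁻ p every v = go (allFin n) every (∈-allFin v)
    where
    go : ∀ l → foldr (λ v b → p v ∧ b) true l ≡ true → v ∈ l → p v ≡ true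
    go (x ∷ l) holds (here refl) = ∧-conicalˡ _ _ holds
    go (x ∷ l) holds (there v∈) = go l (∧-conicalʳ _ _ holds) v∈

  allB-false⁻ : ∀ (p : Fin n → Bool) → allB p ≡ false → ∃ λ v → p v ≡ false
  allB-false⁻ p = go (allFin n)
    where
    go : ∀ l → foldr (λ v b → p v ∧ b) true l ≡ false → ∃ λ v → p v ≡ false
    go (x ∷ l) notAll with p x in px
    ... | false = x , px
    ... | true = go l notAll

  count : VSet n → List (Fin n) → ℕ
  count S l = sum (map (λ v → if S v then 1 else 0) l)

  count-cong : ∀ {S T} l → (∀ {x} → x ∈ l → S x ≡ T x) → count S l ≡ count T l
  count-cong [] S≗T = refl
  count-cong (x ∷ l) S≗T rewrite S≗T (here refl) = cong (_ +_) (count-cong l (S≗T ∘ there))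

  count-insert : ∀ {v S} l → Unique l → v ∈ l → v ∉ᵥ S → count (insert v S) l ≡ suc (count S l)
  count-insert {v} {S} (_ ∷ l) (v∉l ∷ _) (here refl) v∉S rewrite ∈-insert-self v S | v∉S =
    cong suc (count-cong l λ y∈l → insert-other S (≢-sym (All.lookup v∉l y∈l)))
  count-insert {v} {S} (x ∷ l) (x∉l ∷ unique) (there v∈l) v∉S =
    trans (cong₂ (λ b c → (if b then 1 else 0) + c) (insert-other S (All.lookup x∉l v∈l))
                 (count-insert l unique v∈l v∉S))
          (+-suc _ _)

  size-insert : ∀ {v} S → v ∉ᵥ S → size (insert v S) ≡ suc (size S)
  size-insert {v} S = count-insert (allFin n) (Uniqueₚ.allFin⁺ n) (∈-allFin v)

  size-remove : ∀ {c} S → c ∈ᵥ S → size S ≡ suc (size (remove c S))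
  size-remove {c} S c∈S =
    trans (count-cong (allFin n) λ {x} _ → restore x) (size-insert (remove c S) (remove-self c S))
    where
    restore : ∀ x → S x ≡ insert c (remove c S) x
    restore x with x ≟ c
    ... | yes refl = c∈S
    ... | no _ = refl

  size-∅ : size (∅ {n}) ≡ 0
  size-∅ = go (allFin n)
    where
    go : ∀ l → count ∅ l ≡ 0
    go [] = refl
    go (_ ∷ l) = go l

  size-full : size full ≡ n
  size-full = trans (go (allFin n)) (length-tabulate (λ x → x))
    where
    go : ∀ l → count full l ≡ length l
    go [] = refl
    go (_ ∷ l) = cong suc (go l)

  member : ∀ S → 0 < size S → ∃ λ x → x ∈ᵥ S
  member S = go (allFin n)
    where
    go : ∀ l → 0 < count S l → ∃ λ x → x ∈ᵥ S
    go (x ∷ l) pos with S x in x∈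
    ... | true = x , x∈
    ... | false = go l pos

  size≡0⇒∉ : ∀ S → size S ≡ 0 → ∀ x → ¬ x ∈ᵥ S
  size≡0⇒∉ S empty x x∈ with () ← trans (sym (size-remove S x∈)) empty

  size-remove-≥ : ∀ {c k} S → c ∈ᵥ S → suc k ≤ size S → k ≤ size (remove c S)
  size-remove-≥ S c∈S k<size = s≤s⁻¹ (subst (_ ≤_) (size-remove S c∈S) k<size)

  size-remove₂ : ∀ {a b} S → a ≢ b → a ∈ᵥ S → b ∈ᵥ S → size S ≡ suc (suc (size (remove a (remove b S))))
  size-remove₂ {b = b} S a≢b a∈S b∈S =
    trans (size-remove S b∈S) (cong suc (size-remove (remove b S) (∈-remove⁺ S a≢b a∈S)))

  three-members : ∀ S → 3 ≤ size S →
    ∃ λ x → ∃ λ y → ∃ λ z → x ∈ᵥ S × y ∈ᵥ S × z ∈ᵥ S × x ≢ y × x ≢ z × y ≢ z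
  three-members S 3≤size
    with x , x∈S ← member S (≤-trans (s≤s z≤n) 3≤size)
    with y , y∈S₁ ← member (remove x S) (≤-trans (s≤s z≤n) (size-remove-≥ S x∈S 3≤size))
    with z , z∈S₂ ← member (remove y (remove x S)) (size-remove-≥ _ y∈S₁ (size-remove-≥ S x∈S 3≤size))
    with y≢x , y∈S ← ∈-remove⁻ S y∈S₁
    with z≢y , z∈S₁ ← ∈-remove⁻ (remove x S) z∈S₂
    with z≢x , z∈S ← ∈-remove⁻ S z∈S₁
    = x , y , z , x∈S , y∈S , z∈S , ≢-sym y≢x , ≢-sym z≢x , ≢-sym z≢y

  size+size∁ : ∀ S → size S + size (not ∘ S) ≡ n
  size+size∁ S = trans (go (allFin n)) (length-tabulate (λ x → x))
    where
    go : ∀ l → count S l + count (not ∘ S) l ≡ length l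
    go [] = refl
    go (x ∷ l) with S x
    ... | true = cong suc (go l)
    ... | false = trans (+-suc _ _) (cong suc (go l))

  members : VSet n → List (Fin n)
  members S = filter (λ v → T? (S v)) (allFin n)

  ∈-members⁺ : ∀ {x S} → x ∈ᵥ S → x ∈ members S
  ∈-members⁺ {x} {S} x∈S = ∈-filter⁺ (λ v → T? (S v)) (∈-allFin x) (Equivalence.from T-≡ x∈S)

  ∈-members⁻ : ∀ {x S} → x ∈ members S → x ∈ᵥ S
  ∈-members⁻ {x} {S} x∈ = Equivalence.to T-≡ (proj₂ (∈-filter⁻ (λ v → T? (S v)) {xs = allFin n} x∈))

  size≡length-members : ∀ S → size S ≡ length (members S)
  size≡length-members S = go (allFin n)
    where
    go : ∀ l → count S l ≡ length (filter (λ v → T? (S v)) l)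
    go [] = refl
    go (x ∷ l) with S x
    ... | true = cong suc (go l)
    ... | false = go l

-- Walks and breadth-first levels

module _ {n : ℕ} (G : Graph n) where

  infix 4 _~_
  _~_ : Fin n → Fin n → Set
  x ~ y = x ~[ G ] y

  ~-sym : ∀ {x y} → x ~ y → y ~ x
  ~-sym {x} {y} x~y = trans (Graph.sym G y x) x~y

  ~-irrefl : ∀ {x y} → x ~ y → x ≢ y
  ~-irrefl {x} x~x refl with () ← trans (sym x~x) (irrefl G x)

  data Walk (W : VSet n) : Fin n → Fin n → Set where
    stop : ∀ {x} → Walk W x x
    move : ∀ {x y z} → x ~ y → y ∈ᵥ W → Walk W y z → Walk W x z

  ConnectedOn : VSet n → Set
  ConnectedOn W = ∀ {x y} → x ∈ᵥ W → y ∈ᵥ W → Walk W x y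

  walk-++ : ∀ {W x y z} → Walk W x y → Walk W y z → Walk W x z
  walk-++ stop q = q
  walk-++ (move x~y y∈W p) q = move x~y y∈W (walk-++ p q)

  walk-reverse : ∀ {W x y} → x ∈ᵥ W → Walk W x y → Walk W y x
  walk-reverse x∈W stop = stop
  walk-reverse x∈W (move x~y y∈W p) = walk-++ (walk-reverse y∈W p) (move (~-sym x~y) x∈W stop)

  walk-length : ∀ {W x y} → Walk W x y → ℕ
  walk-length stop = 0
  walk-length (move _ _ p) = suc (walk-length p)

  walk-first-step : ∀ {W x y} → Walk W x y → x ≢ y → ∃ λ z → x ~ z × z ∈ᵥ W
  walk-first-step stop x≢x = ⊥-elim (x≢x refl)
  walk-first-step (move x~z z∈W _) _ = _ , x~z , z∈W

  connected⇒connectedOn-full : Connected G → ConnectedOn full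
  connected⇒connectedOn-full conn {x} {y} _ _ = walk (conn x y)
    where
    walk : ∀ {x y} → Reach G x y → Walk full x y
    walk here = stop
    walk (step x~w p) = move x~w refl (walk p)

  record Levelling (W : VSet n) (r : Fin n) : Set where
    field
      root∈W       : r ∈ᵥ W
      level        : Fin n → ℕ
      level-root   : level r ≡ 0
      level≡0⇒root : ∀ {x} → x ∈ᵥ W → level x ≡ 0 → x ≡ r
      level-~      : ∀ {x y} → x ∈ᵥ W → y ∈ᵥ W → x ~ y → level x ≤ suc (level y)
      level-parent : ∀ {x j} → x ∈ᵥ W → level x ≡ suc j → ∃ λ y → y ∈ᵥ W × x ~ y × level y ≡ j

  -- Breadth-first search: ball k is the set of vertices at distance at most k from r in G[W].
  module _ {W r} (conn : ConnectedOn W) (r∈W : r ∈ᵥ W) where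

    private
      ball : ℕ → Fin n → Bool
      ball zero x = does (x ≟ r)
      ball (suc k) x = ball k x ∨ (W x ∧ anyB (λ y → ball k y ∧ adj G y x))

      ball-root : ball 0 r ≡ true
      ball-root with r ≟ r
      ... | yes _ = refl
      ... | no r≢r = ⊥-elim (r≢r refl)

      ball₀⇒root : ∀ {x} → ball 0 x ≡ true → x ≡ r
      ball₀⇒root {x} x∈B₀ with x ≟ r
      ... | yes x≡r = x≡r

      ball-step : ∀ k {x y} → ball k y ≡ true → y ~ x → x ∈ᵥ W → ball (suc k) x ≡ true
      ball-step k {x} {y} y∈B y~x x∈W with ball k x
      ... | true = refl
      ... | false rewrite x∈W = anyB-true⁺ (λ y → ball k y ∧ adj G y x) y-witness
        where
        y-witness : ball k y ∧ adj G y x ≡ true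
        y-witness rewrite y∈B | y~x = refl

      ball-split : ∀ k {x} → ball (suc k) x ≡ true →
        ball k x ≡ true ⊎ (x ∈ᵥ W × ∃ λ y → ball k y ≡ true × y ~ x)
      ball-split k {x} x∈B with ball k x | W x
      ... | true | _ = inj₁ refl
      ... | false | true with y , y∈B∧y~x ← anyB-true⁻ (λ y → ball k y ∧ adj G y x) x∈B
        with ball k y in y∈B | adj G y x in y~x
      ... | true | true = inj₂ (refl , y , y∈B , y~x)

      ball⊆W : ∀ k {x} → ball k x ≡ true → x ∈ᵥ W
      ball⊆W zero x∈B = subst (_∈ᵥ W) (sym (ball₀⇒root x∈B)) r∈W
      ball⊆W (suc k) x∈B with ball-split k x∈B
      ... | inj₁ x∈B′ = ball⊆W k x∈B′
      ... | inj₂ (x∈W , _) = x∈W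

      ball-walk : ∀ {x} (p : Walk W x r) → x ∈ᵥ W → ball (walk-length p) x ≡ true
      ball-walk stop _ = ball-root
      ball-walk (move x~y y∈W p) x∈W = ball-step (walk-length p) (ball-walk p y∈W) (~-sym x~y) x∈W

      distance : ∀ x → ∃ λ k → x ∈ᵥ W → ball k x ≡ true × (∀ {j} → j < k → ball j x ≢ true)
      distance x with W x Bool.≟ true
      ... | no x∉W = 0 , λ x∈W → ⊥-elim (x∉W x∈W)
      ... | yes x∈W with p ← conn x∈W r∈W
        with k , x∈Bₖ , least ← least-witness (λ j → ball j x Bool.≟ true) {walk-length p} (ball-walk p x∈W)
        = k , λ _ → x∈Bₖ , least

      level : Fin n → ℕ
      level x = proj₁ (distance x)

      reached : ∀ {x} → x ∈ᵥ W → ball (level x) x ≡ true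
      reached {x} x∈W = proj₁ (proj₂ (distance x) x∈W)

      level-≤ : ∀ {x} j → x ∈ᵥ W → ball j x ≡ true → level x ≤ j
      level-≤ {x} j x∈W x∈Bⱼ = ≮⇒≥ λ j<level → proj₂ (proj₂ (distance x) x∈W) j<level x∈Bⱼ

      level-~ : ∀ {x y} → x ∈ᵥ W → y ∈ᵥ W → x ~ y → level x ≤ suc (level y)
      level-~ {y = y} x∈W y∈W x~y = level-≤ _ x∈W (ball-step (level y) (reached y∈W) (~-sym x~y) x∈W)

      level-parent : ∀ {x j} → x ∈ᵥ W → level x ≡ suc j → ∃ λ y → y ∈ᵥ W × x ~ y × level y ≡ j
      level-parent {x} {j} x∈W level≡ with ball-split j (subst (λ k → ball k x ≡ true) level≡ (reached x∈W))
      ... | inj₁ x∈Bⱼ = ⊥-elim (proj₂ (proj₂ (distance x) x∈W) (subst (j <_) (sym level≡) ≤-refl) x∈Bⱼ)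
      ... | inj₂ (_ , y , y∈Bⱼ , y~x) =
        y , y∈W , ~-sym y~x , ≤-antisym (level-≤ j y∈W y∈Bⱼ) (s≤s⁻¹ (subst (_≤ suc (level y)) level≡ x≤y+1))
        where
        y∈W = ball⊆W j y∈Bⱼ
        x≤y+1 = level-~ x∈W y∈W (~-sym y~x)

    levelling : Levelling W r
    levelling = record
      { root∈W       = r∈W
      ; level        = level
      ; level-root   = n≤0⇒n≡0 (level-≤ 0 r∈W ball-root)
      ; level≡0⇒root = λ {x} x∈W level≡0 →
          ball₀⇒root (subst (λ k → ball k x ≡ true) level≡0 (reached x∈W))
      ; level-~      = level-~
      ; level-parent = level-parent
      }

  module Levels {W r} (L : Levelling W r) where
    open Levelling L

    ParentClosed : VSet n → Set
    ParentClosed W′ = ∀ {x j} → x ∈ᵥ W′ → level x ≡ suc j → ∃ λ y → y ∈ᵥ W′ × x ~ y × level y ≡ j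

    connected-if-parent-closed : ∀ {W′} → W′ ⊆ᵥ W → r ∈ᵥ W′ → ParentClosed W′ → ConnectedOn W′
    connected-if-parent-closed {W′} W′⊆W r∈W′ closed x∈W′ y∈W′ =
      walk-++ (to-root _ x∈W′ refl) (walk-reverse y∈W′ (to-root _ y∈W′ refl))
      where
      to-root : ∀ k {x} → x ∈ᵥ W′ → level x ≡ k → Walk W′ x r
      to-root zero x∈W′ level≡0 rewrite level≡0⇒root (W′⊆W x∈W′) level≡0 = stop
      to-root (suc k) x∈W′ level≡ with y , y∈W′ , x~y , level-y ← closed x∈W′ level≡ =
        move x~y y∈W′ (to-root k y∈W′ level-y)

    connected-if-lower-kept : ∀ {W′ d} → (∀ {x} → x ∈ᵥ W → level x ≤ d) → 0 < d → W′ ⊆ᵥ W →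
      (∀ {x} → x ∈ᵥ W → level x < d → x ∈ᵥ W′) → ConnectedOn W′
    connected-if-lower-kept {W′} {d} bounded 0<d W′⊆W kept =
      connected-if-parent-closed W′⊆W (kept root∈W (subst (_< d) (sym level-root) 0<d)) closed
      where
      closed : ParentClosed W′
      closed x∈W′ level≡ with y , y∈W , x~y , level-y ← level-parent (W′⊆W x∈W′) level≡ =
        y , kept y∈W (subst (_≤ d) (trans level≡ (cong suc (sym level-y))) (bounded (W′⊆W x∈W′))) ,
        x~y , level-y

    ≢root⇒level>0 : ∀ {x} → x ∈ᵥ W → x ≢ r → 0 < level x
    ≢root⇒level>0 x∈W x≢r = n≢0⇒n>0 (x≢r ∘ level≡0⇒root x∈W)

    level>0⇒≢root : ∀ {x} → 0 < level x → x ≢ r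
    level>0⇒≢root 0<level refl = <-irrefl (sym level-root) 0<level

    level-gap⇒≁ : ∀ {x y} → x ∈ᵥ W → y ∈ᵥ W → suc (level y) < level x → ¬ x ~ y
    level-gap⇒≁ x∈W y∈W gap x~y = <⇒≱ gap (level-~ x∈W y∈W x~y)

    highest : ∃ λ u → u ∈ᵥ W × ∀ {x} → x ∈ᵥ W → level x ≤ level u
    highest =
      argmax level r (members W) ,
      argmax-all level {P = _∈ᵥ W} root∈W (All.tabulate (∈-members⁻ {S = W})) ,
      λ x∈W → All.lookup (f[xs]≤f[argmax] r (members W)) (∈-members⁺ x∈W)

  -- Claw-free graphs: stars and perfect matchings

  Star : VSet n → Fin n → Set
  Star W c = (∀ {x} → x ∈ᵥ W → x ≢ c → c ~ x)
           × (∀ {x y} → x ∈ᵥ W → y ∈ᵥ W → x ≢ c → y ≢ c → ¬ x ~ y)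

  no-claw : ClawFree G → ∀ {c a b d} → c ~ a → c ~ b → c ~ d → a ≢ b → a ≢ d → b ≢ d →
    ¬ a ~ b → ¬ a ~ d → ¬ b ~ d → ⊥
  no-claw claw-free c~a c~b c~d a≢b a≢d b≢d a≁b a≁d b≁d =
    claw-free (_ , _ , _ , _ , c~a , c~b , c~d , a≢b , a≢d , b≢d , ¬-not a≁b , ¬-not a≁d , ¬-not b≁d)

  star-size≤3 : ClawFree G → ∀ W {c} → c ∈ᵥ W → Star W c → size W ≤ 3
  star-size≤3 claw-free W {c} c∈W (spoke , no-rim) = ≮⇒≥ λ 3<size →
    let x , y , z , x∈ , y∈ , z∈ , x≢y , x≢z , y≢z = three-members (remove c W) (size-remove-≥ W c∈W 3<size)
        x≢c , x∈W = ∈-remove⁻ W x∈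
        y≢c , y∈W = ∈-remove⁻ W y∈
        z≢c , z∈W = ∈-remove⁻ W z∈
    in no-claw claw-free (spoke x∈W x≢c) (spoke y∈W y≢c) (spoke z∈W z≢c) x≢y x≢z y≢z
         (no-rim x∈W y∈W x≢c y≢c) (no-rim x∈W z∈W x≢c z≢c) (no-rim y∈W z∈W y≢c z≢c)

  module TopLevel {W r} (L : Levelling W r) {d} (bounded : ∀ {x} → x ∈ᵥ W → Levelling.level L x ≤ d)
                  (0<d : 0 < d) where
    open Levelling L
    open Levels L

    TopEdge : Set
    TopEdge = ∃ λ x → ∃ λ y → x ∈ᵥ W × y ∈ᵥ W × level x ≡ d × level y ≡ d × x ~ y

    top-edge? : Dec TopEdge
    top-edge? = any? λ x → any? λ y →
      (W x Bool.≟ true) ×-dec (W y Bool.≟ true) ×-dec (level x ℕ.≟ d) ×-dec (level y ℕ.≟ d) ×-dec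
      (adj G x y Bool.≟ true)

    below-top : ∀ {x z} → level x ≡ d → level z < d → z ≢ x
    below-top level-x level-z refl = <-irrefl level-x level-z

    top-level⇒≢root : ∀ {x} → level x ≡ d → x ≢ r
    top-level⇒≢root level-x = level>0⇒≢root (subst (0 <_) (sym level-x) 0<d)

    connected-without : ∀ {x} → level x ≡ d → ConnectedOn (remove x W)
    connected-without level-x = connected-if-lower-kept bounded 0<d (proj₂ ∘ ∈-remove⁻ W)
      (λ z∈W z<d → ∈-remove⁺ W (below-top level-x z<d) z∈W)

    connected-without-edge : ∀ {x y} → level x ≡ d → level y ≡ d → ConnectedOn (remove x (remove y W))
    connected-without-edge level-x level-y = connected-if-lower-kept bounded 0<d
      (λ z∈ → proj₂ (∈-remove⁻ W (proj₂ (∈-remove⁻ (remove _ W) z∈))))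
      (λ z∈W z<d →
        ∈-remove⁺ (remove _ W) (below-top level-x z<d) (∈-remove⁺ W (below-top level-y z<d) z∈W))

    star-if-flat : d ≡ 1 → ¬ TopEdge → Star W r
    star-if-flat refl no-top-edge = spoke , no-rim
      where
      at-top : ∀ {x} → x ∈ᵥ W → x ≢ r → level x ≡ 1
      at-top x∈W x≢r = ≤-antisym (bounded x∈W) (≢root⇒level>0 x∈W x≢r)
      spoke : ∀ {x} → x ∈ᵥ W → x ≢ r → r ~ x
      spoke x∈W x≢r with y , y∈W , x~y , level-y ← level-parent x∈W (at-top x∈W x≢r)
        rewrite level≡0⇒root y∈W level-y = ~-sym x~y
      no-rim : ∀ {x y} → x ∈ᵥ W → y ∈ᵥ W → x ≢ r → y ≢ r → ¬ x ~ y
      no-rim x∈W y∈W x≢r y≢r x~y = no-top-edge (_ , _ , x∈W , y∈W , at-top x∈W x≢r , at-top y∈W y≢r , x~y)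

    -- A second top-level neighbour x of the parent w of u would make u, x and the parent z of w
    -- a claw at w, so every other vertex keeps a parent after u and w are removed.
    connected-without-top-and-parent : ClawFree G → ¬ TopEdge → ∀ {u w e} → u ∈ᵥ W → level u ≡ d →
      d ≡ suc (suc e) → w ∈ᵥ W → u ~ w → level w ≡ suc e → ConnectedOn (remove u (remove w W))
    connected-without-top-and-parent claw-free no-top-edge {u} {w} {e} u∈W level-u refl w∈W u~w level-w
      with z , z∈W , w~z , level-z ← level-parent w∈W level-w =
      connected-if-parent-closed W′⊆W
        (keep root∈W (≢-sym (top-level⇒≢root level-u)) (≢-sym (level>0⇒≢root 0<level-w))) closed
      where
      W′ = remove u (remove w W)
      0<level-w : 0 < level w
      0<level-w = subst (0 <_) (sym level-w) (s≤s z≤n)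
      keep : ∀ {x} → x ∈ᵥ W → x ≢ u → x ≢ w → x ∈ᵥ W′
      keep x∈W x≢u x≢w = ∈-remove⁺ (remove w W) x≢u (∈-remove⁺ W x≢w x∈W)
      W′⊆W : W′ ⊆ᵥ W
      W′⊆W x∈W′ = proj₂ (∈-remove⁻ W (proj₂ (∈-remove⁻ (remove w W) x∈W′)))
      z<d : level z < d
      z<d = subst (_< d) (sym level-z) (n≤1+n (suc e))
      closed : ParentClosed W′
      closed {x} {j} x∈W′ level-x with ∈-remove⁻ (remove w W) x∈W′
      ... | x≢u , x∈W₁ with ∈-remove⁻ W x∈W₁
      ... | x≢w , x∈W with y , y∈W , x~y , level-y ← level-parent x∈W level-x with y ≟ w
      ... | no y≢w = y , keep y∈W (below-top level-u y<d) y≢w , x~y , level-y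
        where
        y<d : level y < d
        y<d = subst (_< d) (sym level-y) (subst (_≤ d) level-x (bounded x∈W))
      ... | yes refl = ⊥-elim (no-claw claw-free (~-sym u~w) (~-sym x~y) w~z (≢-sym x≢u)
              (≢-sym (below-top level-u z<d)) (≢-sym (below-top x-top z<d))
              (λ u~x → no-top-edge (u , x , u∈W , x∈W , level-u , x-top , u~x))
              (level-gap⇒≁ u∈W z∈W gap-u) (level-gap⇒≁ x∈W z∈W gap-x))
        where
        x-top : level x ≡ d
        x-top = trans level-x (cong suc (trans (sym level-y) level-w))
        gap-u : suc (level z) < level u
        gap-u rewrite level-z | level-u = ≤-refl
        gap-x : suc (level z) < level x
        gap-x rewrite level-z | x-top = ≤-refl

  -- x₀ only witnesses a second vertex of W, which makes the deepest level positive.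
  module Deepest {W r} (conn : ConnectedOn W) (r∈W : r ∈ᵥ W) {x₀} (x₀∈W : x₀ ∈ᵥ W) (x₀≢r : x₀ ≢ r) where
    L : Levelling W r
    L = levelling conn r∈W

    open Levelling L public
    open Levels L public

    top : Fin n
    top = proj₁ highest

    top∈W : top ∈ᵥ W
    top∈W = proj₁ (proj₂ highest)

    top-highest : ∀ {x} → x ∈ᵥ W → level x ≤ level top
    top-highest = proj₂ (proj₂ highest)

    0<top : 0 < level top
    0<top = ≤-trans (≢root⇒level>0 x₀∈W x₀≢r) (top-highest x₀∈W)

    open TopLevel L top-highest 0<top public

  RemovableEdge : VSet n → Set
  RemovableEdge W = ∃ λ a → ∃ λ b → a ∈ᵥ W × b ∈ᵥ W × a ~ b × ConnectedOn (remove a (remove b W))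

  removable-edge : ClawFree G → ∀ {W k} → ConnectedOn W → size W ≡ suc (suc (k + k)) → RemovableEdge W
  removable-edge claw-free {W} {k} conn sizeW
    with r , r∈W ← member W (subst (0 <_) (sym sizeW) (s≤s z≤n))
    with x , x∈W₁ ← member (remove r W) (size-remove-≥ W r∈W (subst (1 <_) (sym sizeW) (s≤s (s≤s z≤n))))
    = by-shape top-edge?
    where
    open Deepest conn r∈W (proj₂ (∈-remove⁻ W x∈W₁)) (proj₁ (∈-remove⁻ W x∈W₁))

    by-depth : ∀ e → level top ≡ suc e → ¬ TopEdge → RemovableEdge W
    by-depth zero flat no-top-edge =
      top , r , top∈W , r∈W , ~-sym (spoke top∈W top≢r) , λ {x} x∈ _ → ⊥-elim (size≡0⇒∉ _ size₀ x x∈)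
      where
      star = star-if-flat flat no-top-edge
      spoke = proj₁ star
      top≢r = level>0⇒≢root 0<top
      k≡0 : k ≡ 0
      k≡0 = k+k≤1⇒k≡0 (s≤s⁻¹ (s≤s⁻¹ (subst (_≤ 3) sizeW (star-size≤3 claw-free W r∈W star))))
      size₀ : size (remove top (remove r W)) ≡ 0
      size₀ = suc-injective (suc-injective (trans (sym (size-remove₂ W top≢r top∈W r∈W))
                (trans sizeW (cong (λ k → suc (suc (k + k))) k≡0))))
    by-depth (suc e) deep no-top-edge with w , w∈W , top~w , level-w ← level-parent top∈W deep =
      top , w , top∈W , w∈W , top~w ,
      connected-without-top-and-parent claw-free no-top-edge top∈W refl deep w∈W top~w level-w

    by-shape : Dec TopEdge → RemovableEdge W
    by-shape (yes (x , y , x∈W , y∈W , level-x , level-y , x~y)) =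
      x , y , x∈W , y∈W , x~y , connected-without-edge level-x level-y
    by-shape (no no-top-edge) with e , deep ← 0<⇒≡suc 0<top = by-depth e deep no-top-edge

  PerfectMatching : VSet n → Set
  PerfectMatching W = Σ (Fin n → Fin n) λ mate →
    ∀ {x} → x ∈ᵥ W → x ~ mate x × mate x ∈ᵥ W × mate (mate x) ≡ x

  pair-up : Fin n → Fin n → (Fin n → Fin n) → Fin n → Fin n
  pair-up a b f x with x ≟ a | x ≟ b
  ... | yes _ | _ = b
  ... | no _ | yes _ = a
  ... | no _ | no _ = f x

  pair-up-left : ∀ a b f → pair-up a b f a ≡ b
  pair-up-left a b f with a ≟ a
  ... | yes _ = refl
  ... | no a≢a = ⊥-elim (a≢a refl)

  pair-up-right : ∀ {a b} f → a ≢ b → pair-up a b f b ≡ a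
  pair-up-right {a} {b} f a≢b with b ≟ a | b ≟ b
  ... | yes b≡a | _ = ⊥-elim (a≢b (sym b≡a))
  ... | no _ | yes _ = refl
  ... | no _ | no b≢b = ⊥-elim (b≢b refl)

  pair-up-other : ∀ {a b x} f → x ≢ a → x ≢ b → pair-up a b f x ≡ f x
  pair-up-other {a} {b} {x} f x≢a x≢b with x ≟ a | x ≟ b
  ... | yes x≡a | _ = ⊥-elim (x≢a x≡a)
  ... | no _ | yes x≡b = ⊥-elim (x≢b x≡b)
  ... | no _ | no _ = refl

  extend-matching : ∀ {W a b} → a ∈ᵥ W → b ∈ᵥ W → a ~ b →
    PerfectMatching (remove a (remove b W)) → PerfectMatching W
  extend-matching {W} {a} {b} a∈W b∈W a~b (mate′ , matched′) = mate , matched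
    where
    a≢b = ~-irrefl a~b
    mate = pair-up a b mate′
    matched : ∀ {x} → x ∈ᵥ W → x ~ mate x × mate x ∈ᵥ W × mate (mate x) ≡ x
    matched {x} x∈W with x ≟ a | x ≟ b
    ... | yes refl | _ = a~b , b∈W , pair-up-right mate′ a≢b
    ... | no _ | yes refl = ~-sym a~b , a∈W , pair-up-left a b mate′
    ... | no x≢a | no x≢b
      with x~y , y∈W′ , y↦x ← matched′ (∈-remove⁺ (remove b W) x≢a (∈-remove⁺ W x≢b x∈W))
      with y≢a , y∈W₁ ← ∈-remove⁻ (remove b W) y∈W′
      with y≢b , y∈W ← ∈-remove⁻ W y∈W₁
      = x~y , y∈W , trans (pair-up-other mate′ y≢a y≢b) y↦x

  claw-free-perfect-matching : ClawFree G → ∀ k {W} → ConnectedOn W → size W ≡ k + k → PerfectMatching W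
  claw-free-perfect-matching _ zero {W} _ size≡0 = (λ x → x) , λ {x} x∈W → ⊥-elim (size≡0⇒∉ W size≡0 x x∈W)
  claw-free-perfect-matching claw-free (suc k) {W} conn sizeW
    with sizeW′ ← trans sizeW (cong suc (+-suc k k))
    with a , b , a∈W , b∈W , a~b , conn′ ← removable-edge claw-free {k = k} conn sizeW′ =
    extend-matching a∈W b∈W a~b (claw-free-perfect-matching claw-free k conn′
      (suc-injective (suc-injective (trans (sym (size-remove₂ W (~-irrefl a~b) a∈W b∈W)) sizeW′))))

  -- Enclaveless sets and the game

  enclaveless⁺ : ∀ S → (∀ {w} → w ∈ᵥ S → ∃ λ u → w ~ u × u ∉ᵥ S) → enclaveless G S ≡ true
  enclaveless⁺ S escape = cong not (anyB-false⁺ (isEnclave G S) not-enclave)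
    where
    not-enclave : ∀ w → isEnclave G S w ≡ false
    not-enclave w with S w in w∈S
    ... | false = refl
    ... | true with allB (λ u → not (adj G w u) ∨ S u) in closed
    ...   | false = refl
    ...   | true with u , w~u , u∉S ← escape w∈S
      with () ← trans (sym (allB-true⁻ _ closed u)) (cong₂ (λ a b → not a ∨ b) w~u u∉S)

  enclaveless⁻ : ∀ S → enclaveless G S ≡ true → ∀ {w} → w ∈ᵥ S → ∃ λ u → w ~ u × u ∉ᵥ S
  enclaveless⁻ S encl {w} w∈S
    with not-enclave ← anyB-false⁻ (isEnclave G S) (not-injective encl) w
    with u , open-at-u ← allB-false⁻ (λ u → not (adj G w u) ∨ S u)
                           (subst (λ b → b ∧ allB (λ u → not (adj G w u) ∨ S u) ≡ false) w∈S not-enclave)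
    = u , not-injective (∨-conicalˡ _ _ open-at-u) , ∨-conicalʳ _ _ open-at-u

  ¬enclaveless⁻ : ∀ S → enclaveless G S ≡ false → ∃ λ w → w ∈ᵥ S × (∀ {u} → w ~ u → u ∈ᵥ S)
  ¬enclaveless⁻ S ¬encl
    with w , enclave ← anyB-true⁻ (isEnclave G S) (not-injective ¬encl)
    = w , ∧-conicalˡ _ _ enclave , λ {u} w~u →
        subst (λ b → not b ∨ S u ≡ true) w~u (allB-true⁻ _ (∧-conicalʳ _ _ enclave) u)

  ∈-legal⁺ : ∀ {S v} → v ∉ᵥ S → enclaveless G (insert v S) ≡ true → v ∈ legal G S
  ∈-legal⁺ {S} {v} v∉S encl =
    ∈-filter⁺ (λ v → T? (not (S v) ∧ enclaveless G (insert v S))) (∈-allFin v)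
      (Equivalence.from T-≡ (cong₂ _∧_ (cong not v∉S) encl))

  ∈-legal⁻ : ∀ {S v} → v ∈ legal G S → v ∉ᵥ S × enclaveless G (insert v S) ≡ true
  ∈-legal⁻ {S} {v} v∈
    with legal-v ← Equivalence.to T-≡
      (proj₂ (∈-filter⁻ (λ v → T? (not (S v) ∧ enclaveless G (insert v S))) {xs = allFin n} v∈))
    = not-injective (∧-conicalˡ _ _ legal-v) , ∧-conicalʳ _ _ legal-v

  legal≡[]⇒maximal : ∀ {S} → legal G S ≡ [] → ∀ {v} → v ∉ᵥ S → enclaveless G (insert v S) ≡ false
  legal≡[]⇒maximal {S} none {v} v∉S with enclaveless G (insert v S) in encl
  ... | false = refl
  ... | true with () ← subst (v ∈_) none (∈-legal⁺ v∉S encl)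

  DistinctNeighbours : VSet n → Set
  DistinctNeighbours X = Σ (Fin n → Fin n) λ f →
    (∀ {x} → x ∉ᵥ X → x ~ f x) × (∀ {x y} → x ∉ᵥ X → y ∉ᵥ X → f x ≡ f y → x ≡ y)

  matching⇒distinct-neighbours : ∀ {W X} → PerfectMatching W → (∀ {x} → x ∉ᵥ X → x ∈ᵥ W) →
    DistinctNeighbours X
  matching⇒distinct-neighbours (mate , matched) covered =
    mate , (λ x∉X → proj₁ (matched (covered x∉X))) , λ x∉X y∉X same →
      trans (sym (involutive x∉X)) (trans (cong mate same) (involutive y∉X))
    where
    involutive = λ {x} x∉X → proj₂ (proj₂ (matched {x} (covered x∉X)))

  maximal-enclaveless⇒size∁≤size : ∀ {S X} → DistinctNeighbours X → X ⊆ᵥ S →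
    enclaveless G S ≡ true → (∀ {v} → v ∉ᵥ S → enclaveless G (insert v S) ≡ false) →
    size (not ∘ S) ≤ size S
  maximal-enclaveless⇒size∁≤size {S} {X} (f , f-adj , f-inj) X⊆S encl maximal =
    subst₂ _≤_ (sym (size≡length-members (not ∘ S))) (sym (size≡length-members S))
      (injectiveRel⇒length≤ Charge (members (not ∘ S)) (members S)
        (Uniqueₚ.filter⁺ (λ v → T? (not (S v))) (Uniqueₚ.allFin⁺ n)) charge charge-injective)
    where
    Charge : Fin n → Fin n → Set
    Charge x y = x ∉ᵥ S × y ∈ᵥ S × (y ≡ f x ⊎ (∀ {u} → y ~ u → u ∈ᵥ insert x S))

    ∉X : ∀ {x} → x ∉ᵥ S → x ∉ᵥ X
    ∉X x∉S = ¬-not λ x∈X → ∈×∉⇒⊥ {S = S} (X⊆S x∈X) x∉S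

    forced : ∀ {x u} → x ∉ᵥ S → u ∉ᵥ S → u ∈ᵥ insert x S → u ≡ x
    forced {x} x∉S u∉S u∈ with ∈-insert⁻ S u∈
    ... | inj₁ u≡x = u≡x
    ... | inj₂ u∈S = ⊥-elim (∈×∉⇒⊥ {S = S} u∈S u∉S)

    charge : ∀ {x} → x ∈ members (not ∘ S) → ∃ λ y → y ∈ members S × Charge x y
    charge {x} x∈ with x∉S ← not-injective (∈-members⁻ {S = not ∘ S} x∈) with S (f x) in fx∈S
    ... | true = f x , ∈-members⁺ {S = S} fx∈S , x∉S , fx∈S , inj₁ refl
    ... | false with w , w∈ , closed ← ¬enclaveless⁻ (insert x S) (maximal x∉S) with ∈-insert⁻ S w∈
    ...   | inj₂ w∈S = w , ∈-members⁺ {S = S} w∈S , x∉S , w∈S , inj₂ closed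
    ...   | inj₁ refl with x~fx ← f-adj (∉X x∉S) with () ← ~-irrefl x~fx (sym (forced x∉S fx∈S (closed x~fx)))

    charge-injective : ∀ {x x′ y} → Charge x y → Charge x′ y → x ≡ x′
    charge-injective (x∉S , _ , inj₁ y≡fx) (x′∉S , _ , inj₁ y≡fx′) =
      f-inj (∉X x∉S) (∉X x′∉S) (trans (sym y≡fx) y≡fx′)
    charge-injective (x∉S , _ , inj₁ refl) (x′∉S , _ , inj₂ closed′) =
      forced x′∉S x∉S (closed′ (~-sym (f-adj (∉X x∉S))))
    charge-injective (x∉S , _ , inj₂ closed) (x′∉S , _ , inj₁ refl) =
      sym (forced x∉S x′∉S (closed (~-sym (f-adj (∉X x′∉S)))))
    charge-injective (x∉S , y∈S , inj₂ closed) (x′∉S , _ , inj₂ closed′)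
      with u , y~u , u∉S ← enclaveless⁻ S encl y∈S =
      trans (sym (forced x∉S u∉S (closed y~u))) (forced x′∉S u∉S (closed′ y~u))

  legal-cases : ∀ S → legal G S ≡ [] ⊎ ∃ λ v → v ∈ legal G S
  legal-cases S with legal G S
  ... | [] = inj₁ refl
  ... | v ∷ _ = inj₂ (v , here refl)

  value-final : ∀ {k p S} → legal G S ≡ [] → value G (suc k) p S ≡ size S
  value-final {k} {p} {S} none with legal G S
  ... | [] = refl

  value-max-≥ : ∀ {k S v} → v ∈ legal G S →
    value G k Minimizer (insert v S) ≤ value G (suc k) Maximizer S
  value-max-≥ {k} {S} {v} v∈ with legal G S
  ... | w ∷ ws =
    foldr-preservesᵒ {P = g v ≤_} (λ x y → [ m≤n⇒m≤n⊔o y , m≤n⇒m≤o⊔n x ]) (g w) (map g ws) (chosen v∈)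
    where
    g : Fin n → ℕ
    g w = value G k Minimizer (insert w S)
    chosen : v ∈ w ∷ ws → g v ≤ g w ⊎ Any (g v ≤_) (map g ws)
    chosen (here refl) = inj₁ ≤-refl
    chosen (there v∈ws) = inj₂ (Any.map (λ { refl → ≤-refl }) (∈-map⁺ g v∈ws))

  value-min-≥ : ∀ {k S v b} → v ∈ legal G S →
    (∀ {w} → w ∈ legal G S → b ≤ value G k Maximizer (insert w S)) → b ≤ value G (suc k) Minimizer S
  value-min-≥ {k} {S} {v} {b} v∈ bound with legal G S
  ... | w ∷ ws =
    foldr-preservesᵇ {P = b ≤_} ⊓-glb (bound (here refl)) (Allₚ.map⁺ (All.tabulate (bound ∘ there)))

  -- Fuel k + size S ≥ ⌈n/2⌉ guarantees that a game cut off by exhausted fuel has size ≥ ⌈n/2⌉.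
  value-≥-half : ∀ {X} → DistinctNeighbours X → ∀ k p S → enclaveless G S ≡ true → X ⊆ᵥ S →
    ⌈ n /2⌉ ≤ k + size S → ⌈ n /2⌉ ≤ value G k p S
  value-≥-half _ zero p S _ _ fuel = fuel
  value-≥-half {X} neighbours (suc k) p S encl X⊆S fuel with legal-cases S
  ... | inj₁ none = subst (⌈ n /2⌉ ≤_) (sym (value-final none))
        (subst (λ m → ⌈ m /2⌉ ≤ size S) (size+size∁ S)
          (⌈a+b/2⌉≤a (size S) (maximal-enclaveless⇒size∁≤size neighbours X⊆S encl (legal≡[]⇒maximal none))))
  ... | inj₂ (v , v∈) = by-player p
    where
    next : ∀ p′ {w} → w ∈ legal G S → ⌈ n /2⌉ ≤ value G k p′ (insert w S)
    next p′ {w} w∈ with w∉S , encl′ ← ∈-legal⁻ w∈ =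
      value-≥-half neighbours k p′ (insert w S) encl′ (∈-insert⁺ w S ∘ X⊆S)
        (subst (⌈ n /2⌉ ≤_) (trans (sym (+-suc k (size S))) (cong (k +_) (sym (size-insert S w∉S)))) fuel)
    by-player : ∀ p → ⌈ n /2⌉ ≤ value G (suc k) p S
    by-player Maximizer = ≤-trans (next Minimizer v∈) (value-max-≥ v∈)
    by-player Minimizer = value-min-≥ v∈ (next Maximizer)

-- Three-vertex stars

p3adj-centre : ∀ y → y ≢ suc zero → p3adj (suc zero) y ≡ true
p3adj-centre zero _ = refl
p3adj-centre (suc zero) y≢1 = ⊥-elim (y≢1 refl)
p3adj-centre (suc (suc zero)) _ = refl

p3adj-leaves : ∀ x y → x ≢ suc zero → y ≢ suc zero → p3adj x y ≡ false
p3adj-leaves (suc zero) _ x≢1 _ = ⊥-elim (x≢1 refl)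
p3adj-leaves _ (suc zero) _ y≢1 = ⊥-elim (y≢1 refl)
p3adj-leaves zero zero _ _ = refl
p3adj-leaves zero (suc (suc zero)) _ _ = refl
p3adj-leaves (suc (suc zero)) zero _ _ = refl
p3adj-leaves (suc (suc zero)) (suc (suc zero)) _ _ = refl

star₃⇒P3 : ∀ {n} (H : Graph n) {c} → n ≡ 3 → Star H full c → IsP3 H
star₃⇒P3 H {c} refl (spoke , no-rim) =
  f , g , (λ _ → transpose-inverse (suc zero) c) , (λ _ → transpose-inverse c (suc zero)) ,
  λ a b → preserves (a ≟ c) (b ≟ c)
  where
  f g : Fin 3 → Fin 3
  f = transpose c (suc zero)
  g = transpose (suc zero) c

  f-centre : f c ≡ suc zero
  f-centre rewrite dec-true (c ≟ c) refl = refl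

  f≢centre : ∀ {x} → x ≢ c → f x ≢ suc zero
  f≢centre {x} x≢c fx≡1 = x≢c (begin
    x           ≡⟨ sym (transpose-inverse (suc zero) c) ⟩
    g (f x)     ≡⟨ cong g (trans fx≡1 (sym f-centre)) ⟩
    g (f c)     ≡⟨ transpose-inverse (suc zero) c ⟩
    c           ∎)
    where open ≡-Reasoning

  preserves : ∀ {a b} → Dec (a ≡ c) → Dec (b ≡ c) → p3adj (f a) (f b) ≡ adj H a b
  preserves (yes refl) (yes refl) = trans (irrefl P3 (f c)) (sym (irrefl H c))
  preserves {b = b} (yes refl) (no b≢c) rewrite f-centre =
    trans (p3adj-centre (f b) (f≢centre b≢c)) (sym (spoke refl b≢c))
  preserves {a} (no a≢c) (yes refl) rewrite f-centre =
    trans (Graph.sym P3 (f a) (suc zero))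
      (trans (p3adj-centre (f a) (f≢centre a≢c)) (sym (~-sym H (spoke refl a≢c))))
  preserves {a} {b} (no a≢c) (no b≢c) =
    trans (p3adj-leaves (f a) (f b) (f≢centre a≢c) (f≢centre b≢c)) (sym (¬-not (no-rim refl refl a≢c b≢c)))

-- Here every vertex lies in `full` by refl, so implicit vertices and sets are passed explicitly:
-- left to unification they would be sought by evaluating levels and game values.
module Main {m : ℕ} (G : Graph (suc (suc m))) (conn : Connected G) (claw-free : ClawFree G) where

  Vertex : Set
  Vertex = Fin (suc (suc m))

  connected-full : ConnectedOn G full
  connected-full = connected⇒connectedOn-full G conn

  1<size-full : 1 < size (full {suc (suc m)})
  1<size-full = subst (1 <_) (sym (size-full {suc (suc m)})) (s≤s (s≤s z≤n))

  other-vertex : ∀ (x : Vertex) → ∃ λ y → y ≢ x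
  other-vertex x with y , y∈ ← member (remove x full) (size-remove-≥ {c = x} full refl 1<size-full) =
    y , proj₁ (∈-remove⁻ full y∈)

  module Rooted (r : Vertex) =
    Deepest G {r = r} connected-full refl {proj₁ (other-vertex r)} refl (proj₂ (other-vertex r))

  neighbour : ∀ (x : Vertex) → ∃ λ y → x ~[ G ] y
  neighbour x with y , y≢x ← other-vertex x
    with z , x~z , _ ← walk-first-step G (connected-full {x} {y} refl refl) (≢-sym y≢x) = z , x~z

  singleton-enclaveless : ∀ (u : Vertex) → enclaveless G (insert u ∅) ≡ true
  singleton-enclaveless u = enclaveless⁺ G (insert u ∅) escape
    where
    escape : ∀ {w} → w ∈ᵥ insert u ∅ → ∃ λ y → w ~[ G ] y × y ∉ᵥ insert u ∅
    escape {w} w∈ with refl ← ∈-singleton⁻ {x = w} {v = u} w∈ with y , u~y ← neighbour u =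
      y , u~y , insert-other ∅ (≢-sym (~-irrefl G u~y))

  singleton-legal : ∀ (u : Vertex) → u ∈ legal G ∅
  singleton-legal u = ∈-legal⁺ G {S = ∅} {v = u} refl (singleton-enclaveless u)

  size-singleton : ∀ (u : Vertex) → size (insert u ∅) ≡ 1
  size-singleton u = trans (size-insert {v = u} ∅ refl) (cong suc (size-∅ {suc (suc m)}))

  ⌈n/2⌉≤fuel : ∀ k (S : VSet (suc (suc m))) → k + size S ≡ suc (suc m) → ⌈ suc (suc m) /2⌉ ≤ k + size S
  ⌈n/2⌉≤fuel k S exact = subst (⌈ suc (suc m) /2⌉ ≤_) (sym exact) (⌈n/2⌉≤n (suc (suc m)))

  even-distinct-neighbours : ∀ {k} → suc (suc m) ≡ k + k → ∀ X → DistinctNeighbours G X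
  even-distinct-neighbours {k} even X = matching⇒distinct-neighbours G
    (claw-free-perfect-matching G claw-free k connected-full (trans size-full even)) (λ _ → refl)

  odd-distinct-neighbours : ∀ {k c} → suc (suc m) ≡ suc (k + k) → ConnectedOn G (remove c full) →
    DistinctNeighbours G (insert c ∅)
  odd-distinct-neighbours {k} {c} odd conn-c = matching⇒distinct-neighbours G
    (claw-free-perfect-matching G claw-free k conn-c
      (suc-injective (trans (sym (size-remove {c = c} full refl)) (trans size-full odd))))
    (λ {x} x∉ → ∈-remove⁺ {x = x} {c = c} full
                  (λ { refl → ∈×∉⇒⊥ {x = c} {S = insert c ∅} (∈-insert-self c ∅) x∉ }) refl)

  distinct-neighbours-avoiding : ∀ (c : Vertex) → ConnectedOn G (remove c full) →
    DistinctNeighbours G (insert c ∅)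
  distinct-neighbours-avoiding c conn-c with parity (suc (suc m))
  ... | k , inj₁ even = even-distinct-neighbours {k} even (insert c ∅)
  ... | k , inj₂ odd = odd-distinct-neighbours {k} odd conn-c

  Ψ⁺-≥-half : ⌈ suc (suc m) /2⌉ ≤ value G (suc (suc m)) Maximizer ∅
  Ψ⁺-≥-half = ≤-trans
    (value-≥-half G (distinct-neighbours-avoiding top (connected-without {x = top} refl)) (suc m) Minimizer
      (insert top ∅) (singleton-enclaveless top) (λ top∈ → top∈)
      (⌈n/2⌉≤fuel (suc m) (insert top ∅) (trans (cong (suc m +_) (size-singleton top)) (+-comm (suc m) 1))))
    (value-max-≥ G {k = suc m} {S = ∅} {v = top} (singleton-legal top))
    where
    open Rooted zero

  ∉-pair : ∀ {x u v : Vertex} → x ≢ v → x ≢ u → x ∉ᵥ insert v (insert u ∅)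
  ∉-pair {u = u} x≢v x≢u = trans (insert-other (insert u ∅) x≢v) (insert-other ∅ x≢u)

  Reply : Vertex → Set
  Reply u = ∃ λ v → v ≢ u × ConnectedOn G (remove v full) × ∃ λ y → v ~[ G ] y × y ≢ u

  -- A deepest vertex of the levels from u is never a cut vertex, and one with a neighbour other
  -- than u exists unless G is a star centred at u.
  reply : ¬ IsP3 G → ∀ {k} → suc (suc m) ≡ suc (k + k) → ∀ u → Reply u
  reply ¬P3 {k} odd u = by-shape top-edge?
    where
    open Rooted u

    by-depth : ¬ TopEdge → ∀ e → level top ≡ suc e → Reply u
    by-depth no-top-edge zero flat =
      ⊥-elim (¬P3 (star₃⇒P3 G (odd≤3⇒≡3 {m} {k} odd order≤3) star))
      where
      star = star-if-flat flat no-top-edge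
      order≤3 = subst (_≤ 3) size-full (star-size≤3 G claw-free full refl star)
    by-depth _ (suc e) deep =
      let w , _ , top~w , level-w = level-parent {x = top} refl deep in
      top , top-level⇒≢root {x = top} refl , connected-without {x = top} refl ,
      w , top~w , level>0⇒≢root {x = w} (subst (0 <_) (sym level-w) (s≤s z≤n))

    by-shape : Dec TopEdge → Reply u
    by-shape (yes (x , y , _ , _ , level-x , level-y , x~y)) =
      x , top-level⇒≢root {x = x} level-x , connected-without {x = x} level-x ,
      y , x~y , top-level⇒≢root {x = y} level-y
    by-shape (no no-top-edge) = let e , deep = 0<⇒≡suc 0<top in by-depth no-top-edge e deep

  reply-enclaveless : ∀ {u v y} → v ≢ u → ConnectedOn G (remove v full) → v ~[ G ] y → y ≢ u →
    enclaveless G (insert v (insert u ∅)) ≡ true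
  reply-enclaveless {u} {v} {y} v≢u conn-v v~y y≢u
    with z , u~z , z∈ ← walk-first-step G
      (conn-v (∈-remove⁺ {x = u} full (≢-sym v≢u) refl)
              (∈-remove⁺ {x = y} full (≢-sym (~-irrefl G v~y)) refl))
      (≢-sym y≢u)
    = enclaveless⁺ G (insert v (insert u ∅)) escape
    where
    escape : ∀ {w} → w ∈ᵥ insert v (insert u ∅) → ∃ λ x → w ~[ G ] x × x ∉ᵥ insert v (insert u ∅)
    escape {w} w∈ with ∈-insert⁻ {x = w} {v = v} (insert u ∅) w∈
    ... | inj₁ refl = y , v~y , ∉-pair (≢-sym (~-irrefl G v~y)) y≢u
    ... | inj₂ w∈′ with refl ← ∈-singleton⁻ {x = w} {v = u} w∈′ =
      z , u~z , ∉-pair (proj₁ (∈-remove⁻ {x = z} {c = v} full z∈)) (≢-sym (~-irrefl G u~z))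

  after-minimizer-even : ∀ {k} → suc (suc m) ≡ k + k → ∀ u →
    ⌈ suc (suc m) /2⌉ ≤ value G (suc m) Maximizer (insert u ∅)
  after-minimizer-even {k} even u =
    value-≥-half G (even-distinct-neighbours {k} even (insert u ∅)) (suc m) Maximizer (insert u ∅)
      (singleton-enclaveless u) (λ u∈ → u∈)
      (⌈n/2⌉≤fuel (suc m) (insert u ∅) (trans (cong (suc m +_) (size-singleton u)) (+-comm (suc m) 1)))

  after-minimizer-odd : ¬ IsP3 G → ∀ {k} → suc (suc m) ≡ suc (k + k) → ∀ u →
    ⌈ suc (suc m) /2⌉ ≤ value G (suc m) Maximizer (insert u ∅)
  after-minimizer-odd ¬P3 {k} odd u = answer (reply ¬P3 {k} odd u)
    where
    answer : Reply u → ⌈ suc (suc m) /2⌉ ≤ value G (suc m) Maximizer (insert u ∅)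
    answer (v , v≢u , conn-v , y , v~y , y≢u) = ≤-trans
      (value-≥-half G (odd-distinct-neighbours {k} {v} odd conn-v) m Minimizer S₂ encl
        (λ {x} x∈ → subst (_∈ᵥ S₂) (sym (∈-singleton⁻ {x = x} x∈)) (∈-insert-self v (insert u ∅)))
        (⌈n/2⌉≤fuel m S₂ (trans (cong (m +_) size-pair) (+-comm m 2))))
      (value-max-≥ G {k = m} {S = insert u ∅} {v = v}
        (∈-legal⁺ G {S = insert u ∅} {v = v} (insert-other ∅ v≢u) encl))
      where
      S₂ = insert v (insert u ∅)
      encl = reply-enclaveless v≢u conn-v v~y y≢u
      size-pair : size S₂ ≡ 2
      size-pair =
        trans (size-insert {v = v} (insert u ∅) (insert-other ∅ v≢u)) (cong suc (size-singleton u))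

  Ψ⁻-≥-half : ¬ IsP3 G → ⌈ suc (suc m) /2⌉ ≤ value G (suc (suc m)) Minimizer ∅
  Ψ⁻-≥-half ¬P3 = value-min-≥ G {k = suc m} {S = ∅} {v = zero} (singleton-legal zero) λ {u} _ →
    case parity (suc (suc m)) of λ where
      (k , inj₁ even) → after-minimizer-even {k} even u
      (k , inj₂ odd) → after-minimizer-odd ¬P3 {k} odd u

theorem5p10 : (n : ℕ) → 2 ≤ n → (G : Graph n) → Connected G → ClawFree G →
    (n ≤ 2 * Ψ⁺ G) × (¬ IsP3 G → n ≤ 2 * Ψ⁻ G)
theorem5p10 (suc (suc m)) (s≤s (s≤s z≤n)) G conn claw-free =
  ⌈n/2⌉≤m⇒n≤2m _ Ψ⁺-≥-half , ⌈n/2⌉≤m⇒n≤2m _ ∘ Ψ⁻-≥-half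
  where
  open Main G conn claw-free
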